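{- For every integer $n\geqslant 1$, the (4,5,6)-fullerene $T_n$ is not 2-extendable. Equivalently, every (4,5,6)-fullerene in the family $\mathcal{T}=\{T_n\mid n\geqslant 1\}$ is non-2-extendable.
   Context: All graphs are simple. A (4,5,6)-fullerene is a plane (spherical) cubic graph all of whose faces are quadrilaterals, pentagons or hexagons. A matching of a graph is a set of edges no two of which share an endvertex; a perfect matching is a matching covering every vertex. A connected graph $G$ with at least $2k+2$ vertices is $k$-extendable if $G$ has a matching of size $k$ and every matching of size $k$ in $G$ is contained in a perfect matching of $G$. For $n\geqslant 1$, $T_n$ denotes the (4,5,6)-fullerene consisting of $n$ concentric layers of hexagons, capped on each end by a cap formed by three quadrilaterals sharing one common vertex (so the boundary of each cap is a 6-cycle, and consecutive non-facial concentric 6-cycles are joined by edges). -}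

module Defs where

open import Data.Nat using (ℕ; zero; suc; _+_; _*_; _%_)
open import Data.Fin using (Fin; zero; suc; toℕ; inject₁; fromℕ)
open import Data.Product using (Σ; ∃; _×_; _,_; proj₁; proj₂)
open import Data.Sum using (_⊎_)
open import Data.List using (List; length)
open import Data.List.Relation.Unary.All using (All)
open import Data.List.Relation.Unary.Any using (Any)
open import Data.List.Relation.Unary.AllPairs using (AllPairs)
open import Relation.Binary.PropositionalEquality using (_≡_; _≢_)
open import Function.Bundles using (_↣_)

-- Generic graph notions.  A graph is a vertex type V with an adjacency
-- relation Adj (for us always symmetric and irreflexive).

module _ {V : Set} (Adj : V → V → Set) where

  Edge : Set
  Edge = Σ V λ u → Σ V λ v → Adj u v

  end₁ end₂ : Edge → V
  end₁ e = proj₁ e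
  end₂ e = proj₁ (proj₂ e)

  Covers : Edge → V → Set
  Covers e x = (end₁ e ≡ x) ⊎ (end₂ e ≡ x)

  Disjoint : Edge → Edge → Set
  Disjoint e f = (end₁ e ≢ end₁ f) × (end₁ e ≢ end₂ f)
               × (end₂ e ≢ end₁ f) × (end₂ e ≢ end₂ f)

  IsMatching : List Edge → Set
  IsMatching M = AllPairs Disjoint M

  IsMatchingOfSize : ℕ → List Edge → Set
  IsMatchingOfSize k M = IsMatching M × (length M ≡ k)

  IsPerfectMatching : List Edge → Set
  IsPerfectMatching M = IsMatching M × (∀ x → Any (λ e → Covers e x) M)

  SameEdge : Edge → Edge → Set
  SameEdge e f = ((end₁ e ≡ end₁ f) × (end₂ e ≡ end₂ f))
               ⊎ ((end₁ e ≡ end₂ f) × (end₂ e ≡ end₁ f))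

  _⊆E_ : List Edge → List Edge → Set
  M ⊆E P = All (λ e → Any (SameEdge e) P) M

  data Reach : V → V → Set where
    here : ∀ {x} → Reach x x
    step : ∀ {x y z} → Adj x y → Reach y z → Reach x z

  Connected : Set
  Connected = ∀ x y → Reach x y

  AtLeastVertices : ℕ → Set
  AtLeastVertices m = Fin m ↣ V

  KExtendable : ℕ → Set
  KExtendable k =
    Connected × AtLeastVertices (2 * k + 2)
    × (∃ λ M → IsMatchingOfSize k M)
    × (∀ M → IsMatchingOfSize k M →
         ∃ λ P → IsPerfectMatching P × (M ⊆E P))

-- Vertices: two cap centres (bot, top) and concentric 6-cycles
-- C_0, ..., C_n, vertex cyc k i = i-th vertex of C_k (i mod 6).
-- C_0 and C_n are the boundaries of the two caps; consecutive cycles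
-- are joined by 3 alternating edges, giving n layers of 3 hexagons.

data TV (n : ℕ) : Set where
  bot top : TV n
  cyc     : Fin (suc n) → Fin 6 → TV n

next6 : Fin 6 → Fin 6
next6 zero = suc zero
next6 (suc zero) = suc (suc zero)
next6 (suc (suc zero)) = suc (suc (suc zero))
next6 (suc (suc (suc zero))) = suc (suc (suc (suc zero)))
next6 (suc (suc (suc (suc zero)))) = suc (suc (suc (suc (suc zero))))
next6 (suc (suc (suc (suc (suc zero))))) = zero

data TAdj (n : ℕ) : TV n → TV n → Set where
  ring   : ∀ k i → TAdj n (cyc k i) (cyc k (next6 i))
  ring′  : ∀ k i → TAdj n (cyc k (next6 i)) (cyc k i)
  spoke  : ∀ (k : Fin n) i → (toℕ k + toℕ i) % 2 ≡ 1 →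
           TAdj n (cyc (inject₁ k) i) (cyc (suc k) i)
  spoke′ : ∀ (k : Fin n) i → (toℕ k + toℕ i) % 2 ≡ 1 →
           TAdj n (cyc (suc k) i) (cyc (inject₁ k) i)
  botE   : ∀ i → toℕ i % 2 ≡ 0 → TAdj n bot (cyc zero i)
  botE′  : ∀ i → toℕ i % 2 ≡ 0 → TAdj n (cyc zero i) bot
  -- top cap: centre adjacent to the positions of C_n not joined to C_{n-1}
  topE   : ∀ i → (n + toℕ i) % 2 ≡ 1 → TAdj n top (cyc (fromℕ n) i)
  topE′  : ∀ i → (n + toℕ i) % 2 ≡ 1 → TAdj n (cyc (fromℕ n) i) top

{-# OPTIONS --safe #-}
module Submission where

-- The two spokes joining positions 1 and 3 of the bottom boundary cycle C₀
-- to C₁ form a 2-matching with no perfect extension: the even positions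
-- 0, 2, 4 of C₀ are adjacent only to the cap centre and to the odd
-- positions 1, 3, 5 of C₀, and once 1 and 3 are matched along the spokes,
-- three vertices are left with only two possible partners.

open import Defs
open import Data.Nat using (ℕ; zero; suc; _≥_; _%_)
open import Data.Fin using (Fin; zero; suc; toℕ; #_)
open import Data.Product using (∃; _,_; proj₁; proj₂)
open import Data.Sum using (_⊎_; inj₁; inj₂)
open import Data.Empty using (⊥; ⊥-elim)
open import Data.List using (List; []; _∷_)
open import Data.List.Relation.Unary.All as All using (All; []; _∷_; lookupWith)
open import Data.List.Relation.Unary.Any as Any using (Any; here; there)
open import Data.List.Relation.Unary.AllPairs using ([]; _∷_)
open import Relation.Binary.Definitions using (Symmetric)
open import Relation.Binary.PropositionalEquality using (_≡_; refl; sym; trans; cong)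
open import Relation.Nullary using (¬_)

module PerfectMatchings {V : Set} (Adj : V → V → Set) where

  data Joins : Edge Adj → V → V → Set where
    forward  : ∀ {x y} (a : Adj x y) → Joins (x , y , a) x y
    backward : ∀ {x y} (a : Adj y x) → Joins (y , x , a) x y

  joins-sym : ∀ {e x y} → Joins e x y → Joins e y x
  joins-sym (forward a)  = backward a
  joins-sym (backward a) = forward a

  joins-functional : ∀ {e x y z} → Joins e x y → Joins e x z → y ≡ z
  joins-functional (forward _)  (forward _)  = refl
  joins-functional (forward _)  (backward _) = refl
  joins-functional (backward _) (forward _)  = refl
  joins-functional (backward _) (backward _) = refl

  covers⇒joins : ∀ {e x} → Covers Adj e x → ∃ λ y → Joins e x y
  covers⇒joins {_ , _ , a} (inj₁ refl) = _ , forward a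
  covers⇒joins {_ , _ , a} (inj₂ refl) = _ , backward a

  joins⇒adj : Symmetric Adj → ∀ {e x y} → Joins e x y → Adj x y
  joins⇒adj adj-sym (forward a)  = a
  joins⇒adj adj-sym (backward a) = adj-sym a

  sameEdge⇒joins : ∀ {e f} → SameEdge Adj e f → Joins f (end₁ Adj e) (end₂ Adj e)
  sameEdge⇒joins {f = _ , _ , b} (inj₁ (refl , refl)) = forward b
  sameEdge⇒joins {f = _ , _ , b} (inj₂ (refl , refl)) = backward b

  disjoint⇒¬joins-both : ∀ {e f x y z} → Disjoint Adj e f → Joins e x y → Joins f x z → ⊥
  disjoint⇒¬joins-both (d₁₁ , _ , _ , _) (forward _)  (forward _)  = d₁₁ refl
  disjoint⇒¬joins-both (_ , d₁₂ , _ , _) (forward _)  (backward _) = d₁₂ refl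
  disjoint⇒¬joins-both (_ , _ , d₂₁ , _) (backward _) (forward _)  = d₂₁ refl
  disjoint⇒¬joins-both (_ , _ , _ , d₂₂) (backward _) (backward _) = d₂₂ refl

  ¬joined-twice : ∀ {e x y z Q} → All (Disjoint Adj e) Q → Joins e x y →
                  ¬ Any (λ f → Joins f x z) Q
  ¬joined-twice {e} ds j =
    lookupWith {P = Disjoint Adj e} {R = λ _ → ⊥} (λ d k → disjoint⇒¬joins-both d j k) ds

  MatchedTo : List (Edge Adj) → V → V → Set
  MatchedTo P x y = Any (λ e → Joins e x y) P

  matchedTo-sym : ∀ {P x y} → MatchedTo P x y → MatchedTo P y x
  matchedTo-sym = Any.map joins-sym

  matchedTo-functional : ∀ {P} → IsMatching Adj P → ∀ {x y z} →
                         MatchedTo P x y → MatchedTo P x z → y ≡ z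
  matchedTo-functional (_ ∷ _)  (here j)  (here k)  = joins-functional j k
  matchedTo-functional (ds ∷ _) (here j)  (there k) = ⊥-elim (¬joined-twice ds j k)
  matchedTo-functional (ds ∷ _) (there j) (here k)  = ⊥-elim (¬joined-twice ds k j)
  matchedTo-functional (_ ∷ M)  (there j) (there k) = matchedTo-functional M j k

  matchedTo-injective : ∀ {P} → IsMatching Adj P → ∀ {x y z} →
                        MatchedTo P x z → MatchedTo P y z → x ≡ y
  matchedTo-injective M j k = matchedTo-functional M (matchedTo-sym j) (matchedTo-sym k)

  matchedTo⇒adj : ∀ {P} → Symmetric Adj → ∀ {x y} → MatchedTo P x y → Adj x y
  matchedTo⇒adj adj-sym j = joins⇒adj adj-sym (proj₂ (Any.satisfied j))

  perfect⇒matchedTo : ∀ {P} → IsPerfectMatching Adj P → ∀ x → ∃ λ y → MatchedTo P x y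
  perfect⇒matchedTo (_ , covered) x = go (covered x)
    where
    go : ∀ {Q} → Any (λ e → Covers Adj e x) Q → ∃ λ y → MatchedTo Q x y
    go (here c)  = let y , j = covers⇒joins c in y , here j
    go (there c) = let y , j = go c in y , there j

  ⊆E⇒matchedTo : ∀ M {P} → _⊆E_ Adj M P → All (λ e → MatchedTo P (end₁ Adj e) (end₂ Adj e)) M
  ⊆E⇒matchedTo M = All.map (λ {e} → Any.map (sameEdge⇒joins {e}))

prev6 : Fin 6 → Fin 6
prev6 zero                               = suc (suc (suc (suc (suc zero))))
prev6 (suc zero)                         = zero
prev6 (suc (suc zero))                   = suc zero
prev6 (suc (suc (suc zero)))             = suc (suc zero)
prev6 (suc (suc (suc (suc zero))))       = suc (suc (suc zero))
prev6 (suc (suc (suc (suc (suc zero))))) = suc (suc (suc (suc zero)))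

prev6-next6 : ∀ i → prev6 (next6 i) ≡ i
prev6-next6 zero                               = refl
prev6-next6 (suc zero)                         = refl
prev6-next6 (suc (suc zero))                   = refl
prev6-next6 (suc (suc (suc zero)))             = refl
prev6-next6 (suc (suc (suc (suc zero))))       = refl
prev6-next6 (suc (suc (suc (suc (suc zero))))) = refl

TAdj-sym : ∀ {n} → Symmetric (TAdj n)
TAdj-sym (ring k i)     = ring′ k i
TAdj-sym (ring′ k i)    = ring k i
TAdj-sym (spoke k i p)  = spoke′ k i p
TAdj-sym (spoke′ k i p) = spoke k i p
TAdj-sym (botE i p)     = botE′ i p
TAdj-sym (botE′ i p)    = botE i p
TAdj-sym (topE i p)     = topE′ i p
TAdj-sym (topE′ i p)    = topE i p

-- For n ≥ 1 the cycle C₀ differs from C_n, so no edge to top starts on C₀.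
C₀-even-neighbour : ∀ {m i v} → toℕ i % 2 ≡ 0 → TAdj (suc m) (cyc zero i) v →
                    v ≡ bot ⊎ v ≡ cyc zero (prev6 i) ⊎ v ≡ cyc zero (next6 i)
C₀-even-neighbour even a = go even a refl
  where
  go : ∀ {m i u v} → toℕ i % 2 ≡ 0 → TAdj (suc m) u v → u ≡ cyc zero i →
       v ≡ bot ⊎ v ≡ cyc zero (prev6 i) ⊎ v ≡ cyc zero (next6 i)
  go _    (ring zero i)      refl = inj₂ (inj₂ refl)
  go _    (ring′ zero i)     refl = inj₂ (inj₁ (cong (cyc zero) (sym (prev6-next6 i))))
  go even (spoke zero i odd) refl with () ← trans (sym even) odd
  go _    (botE′ i _)        refl = inj₁ refl

module _ {m : ℕ} where
  open PerfectMatchings (TAdj (suc m))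

  bottom-spokes : List (Edge (TAdj (suc m)))
  bottom-spokes = (cyc zero (# 1) , cyc (suc zero) (# 1) , spoke zero (# 1) refl)
                ∷ (cyc zero (# 3) , cyc (suc zero) (# 3) , spoke zero (# 3) refl)
                ∷ []

  bottom-spokes-isMatching : IsMatchingOfSize (TAdj (suc m)) 2 bottom-spokes
  bottom-spokes-isMatching = ((((λ ()) , (λ ()) , (λ ()) , (λ ())) ∷ []) ∷ [] ∷ []) , refl

  module _ {P : List (Edge (TAdj (suc m)))} (P-perfect : IsPerfectMatching (TAdj (suc m)) P) where

    C₀-even-mate : ∀ i → toℕ i % 2 ≡ 0 →
                   MatchedTo P (cyc zero i) bot
                   ⊎ MatchedTo P (cyc zero i) (cyc zero (prev6 i))
                   ⊎ MatchedTo P (cyc zero i) (cyc zero (next6 i))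
    C₀-even-mate i even with perfect⇒matchedTo P-perfect (cyc zero i)
    ... | _ , j with C₀-even-neighbour even (matchedTo⇒adj TAdj-sym j)
    ... | inj₁ refl        = inj₁ j
    ... | inj₂ (inj₁ refl) = inj₂ (inj₁ j)
    ... | inj₂ (inj₂ refl) = inj₂ (inj₂ j)

    same-mate : ∀ {x y z} → MatchedTo P x z → MatchedTo P y z → x ≡ y
    same-mate = matchedTo-injective (proj₁ P-perfect)

    C₀-evens-unmatchable : MatchedTo P (cyc (suc zero) (# 1)) (cyc zero (# 1)) →
                           MatchedTo P (cyc (suc zero) (# 3)) (cyc zero (# 3)) → ⊥
    -- Position 2 is forced onto bot, then 4 onto 5, and 0 is left without a partner.
    C₀-evens-unmatchable j₁ j₃
      with C₀-even-mate (# 2) refl | C₀-even-mate (# 4) refl | C₀-even-mate (# 0) refl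
    ... | inj₂ (inj₁ j₂₁) | _ | _ with () ← same-mate j₂₁ j₁
    ... | inj₂ (inj₂ j₂₃) | _ | _ with () ← same-mate j₂₃ j₃
    ... | inj₁ j₂ | inj₁ j₄ | _ with () ← same-mate j₂ j₄
    ... | _ | inj₂ (inj₁ j₄₃) | _ with () ← same-mate j₄₃ j₃
    ... | inj₁ j₂ | _ | inj₁ j₀ with () ← same-mate j₂ j₀
    ... | _ | inj₂ (inj₂ j₄₅) | inj₂ (inj₁ j₀₅) with () ← same-mate j₄₅ j₀₅
    ... | _ | _ | inj₂ (inj₂ j₀₁) with () ← same-mate j₀₁ j₁

    bottom-spokes-unextendable : ¬ _⊆E_ (TAdj (suc m)) bottom-spokes P
    bottom-spokes-unextendable spokes⊆P with ⊆E⇒matchedTo bottom-spokes spokes⊆P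
    ... | j₁ ∷ j₃ ∷ [] = C₀-evens-unmatchable (matchedTo-sym j₁) (matchedTo-sym j₃)

lemma2p5 : ∀ (n : ℕ) → n ≥ 1 → ¬ KExtendable (TAdj n) 2
lemma2p5 zero    ()
lemma2p5 (suc m) _  (_ , _ , _ , extends) =
  let _ , P-perfect , spokes⊆P = extends bottom-spokes bottom-spokes-isMatching
  in  bottom-spokes-unextendable P-perfect spokes⊆P
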